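{- Let $(a_n/b_n,c_n/d_n)$ be the Farey pair at a node of depth $n$ in the Farey pair tree $\mathcal{F}$, and for $i=0,\dots,n$ let $(a_i/b_i,c_i/d_i)$ be the Farey pairs at the nodes of depth $i$ along the path from the root to that node. Then all the numbers $a_i,b_i,c_i,d_i$ ($0\le i\le n$) are bounded by $(n+1)(a_n+b_n)$.
   Context: The Farey pair tree $\mathcal{F}$ assigns to each position $\sigma\in\{0,1\}^*$ a pair of fractions (numerators and denominators as produced by the construction): $\mathcal{F}(\epsilon)=(0/1,1/1)$, and if $\mathcal{F}(\sigma)=(a/b,c/d)$ then $\mathcal{F}(\sigma0)=(a/b,(a+c)/(b+d))$ and $\mathcal{F}(\sigma1)=((a+c)/(b+d),c/d)$. The depth of the node at $\sigma$ is the length of $\sigma$. -}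

module Defs where

open import Data.Nat using (ℕ; _+_)
open import Data.Bool using (Bool; true; false)
open import Data.List using (List; []; _∷_)

-- A Farey pair (a/b, c/d) recorded by its raw numerators and denominators
-- (as produced by the construction; no reduction takes place).
record FareyPair : Set where
  constructor fp
  field
    a b c d : ℕ

open FareyPair public

-- Positions σ ∈ {0,1}* are lists of Bool: false = 0, true = 1,
-- read left to right from the root.
-- F(σ0) = (a/b, (a+c)/(b+d)),  F(σ1) = ((a+c)/(b+d), c/d).
child : FareyPair → Bool → FareyPair
child (fp a b c d) false = fp a b (a + c) (b + d)
child (fp a b c d) true  = fp (a + c) (b + d) c d

fareyFrom : FareyPair → List Bool → FareyPair
fareyFrom p []       = p
fareyFrom p (x ∷ σ)  = fareyFrom (child p x) σ

F : List Bool → FareyPair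
F = fareyFrom (fp 0 1 1 1)

{-# OPTIONS --safe #-}
-- Entries never decrease along a path, since a child keeps one endpoint and replaces the
-- other by the mediant; so every ancestor is dominated entrywise by the final pair
-- (a/b, c/d).  For that pair, c ≤ n·a + 1 and d ≤ n·b + 1 by induction on the depth n:
-- a left step adds a to c, and after a right step c is at most the new numerator.
-- With b ≥ 1 every entry is then at most (n + 1)(a + b).
module Submission where

open import Defs
open import Data.Nat using (ℕ; _+_; _*_; _≤_; suc; zero; z≤n; s≤s)
open import Data.Nat.Properties
open import Data.Bool using (Bool; true; false)
open import Data.List using (List; length; take; []; _∷_)
open import Data.Product using (_×_; _,_)
open import Relation.Binary.PropositionalEquality using (sym; subst)

infix 4 _≤ᶠ_

_≤ᶠ_ : FareyPair → FareyPair → Set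
p ≤ᶠ q = (a p ≤ a q) × (b p ≤ b q) × (c p ≤ c q) × (d p ≤ d q)

≤ᶠ-refl : ∀ p → p ≤ᶠ p
≤ᶠ-refl p = ≤-refl , ≤-refl , ≤-refl , ≤-refl

≤ᶠ-trans : ∀ {p q r} → p ≤ᶠ q → q ≤ᶠ r → p ≤ᶠ r
≤ᶠ-trans (a≤ , b≤ , c≤ , d≤) (a≤′ , b≤′ , c≤′ , d≤′) =
  ≤-trans a≤ a≤′ , ≤-trans b≤ b≤′ , ≤-trans c≤ c≤′ , ≤-trans d≤ d≤′

≤ᶠ-child : ∀ p x → p ≤ᶠ child p x
≤ᶠ-child (fp a b c d) false = ≤-refl , ≤-refl , m≤n+m c a , m≤n+m d b
≤ᶠ-child (fp a b c d) true  = m≤m+n a c , m≤m+n b d , ≤-refl , ≤-refl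

≤ᶠ-fareyFrom : ∀ p σ → p ≤ᶠ fareyFrom p σ
≤ᶠ-fareyFrom p []      = ≤ᶠ-refl p
≤ᶠ-fareyFrom p (x ∷ σ) = ≤ᶠ-trans (≤ᶠ-child p x) (≤ᶠ-fareyFrom (child p x) σ)

fareyFrom-take-≤ᶠ : ∀ p σ i → fareyFrom p (take i σ) ≤ᶠ fareyFrom p σ
fareyFrom-take-≤ᶠ p σ       zero    = ≤ᶠ-fareyFrom p σ
fareyFrom-take-≤ᶠ p []      (suc i) = ≤ᶠ-refl p
fareyFrom-take-≤ᶠ p (x ∷ σ) (suc i) = fareyFrom-take-≤ᶠ (child p x) σ i

LinearlyBounded : ℕ → FareyPair → Set
LinearlyBounded k p = (c p ≤ k * a p + 1) × (d p ≤ k * b p + 1) × (1 ≤ b p)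

+-mono-linear : ∀ k m n → n ≤ k * m + 1 → m + n ≤ suc k * m + 1
+-mono-linear k m n n≤ = subst (m + n ≤_) (sym (+-assoc m (k * m) 1)) (+-monoʳ-≤ m n≤)

m≤[1+k]*m+1 : ∀ k m → m ≤ suc k * m + 1
m≤[1+k]*m+1 k m = ≤-trans (m≤m+n m (k * m)) (m≤m+n (suc k * m) 1)

linearlyBounded-child : ∀ k p x → LinearlyBounded k p → LinearlyBounded (suc k) (child p x)
linearlyBounded-child k (fp a b c d) false (c≤ , d≤ , 1≤b) =
  +-mono-linear k a c c≤ , +-mono-linear k b d d≤ , 1≤b
linearlyBounded-child k (fp a b c d) true  (c≤ , d≤ , 1≤b) =
  ≤-trans (m≤n+m c a) (m≤[1+k]*m+1 k (a + c)) ,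
  ≤-trans (m≤n+m d b) (m≤[1+k]*m+1 k (b + d)) ,
  ≤-trans 1≤b (m≤m+n b d)

linearlyBounded-fareyFrom : ∀ k p σ → LinearlyBounded k p →
                            LinearlyBounded (k + length σ) (fareyFrom p σ)
linearlyBounded-fareyFrom k p []      bnd =
  subst (λ m → LinearlyBounded m p) (sym (+-identityʳ k)) bnd
linearlyBounded-fareyFrom k p (x ∷ σ) bnd =
  subst (λ m → LinearlyBounded m (fareyFrom p (x ∷ σ))) (sym (+-suc k (length σ)))
    (linearlyBounded-fareyFrom (suc k) (child p x) σ (linearlyBounded-child k p x bnd))

linearlyBounded-F : ∀ σ → LinearlyBounded (length σ) (F σ)
linearlyBounded-F σ = linearlyBounded-fareyFrom 0 (fp 0 1 1 1) σ (s≤s z≤n , s≤s z≤n , s≤s z≤n)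

n*m+1≤[1+n]*k : ∀ n m k → 1 ≤ k → m ≤ k → n * m + 1 ≤ suc n * k
n*m+1≤[1+n]*k n m k 1≤k m≤k =
  subst (n * m + 1 ≤_) (+-comm (n * k) k) (+-mono-≤ (*-monoʳ-≤ n m≤k) 1≤k)

mainTheorem10 : (σ : List Bool) → (i : ℕ) → i ≤ length σ →
    let n = length σ
        N = suc n * (a (F σ) + b (F σ))
        P = F (take i σ)
    in (a P ≤ N) × (b P ≤ N) × (c P ≤ N) × (d P ≤ N)
mainTheorem10 σ i _ =
  let a≤ , b≤ , c≤ , d≤ = fareyFrom-take-≤ᶠ (fp 0 1 1 1) σ i
      c≤nA+1 , d≤nB+1 , 1≤B = linearlyBounded-F σ
      1≤A+B = ≤-trans 1≤B (m≤n+m B A)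
  in ≤-trans a≤ (≤-trans (m≤m+n A B) A+B≤N) ,
     ≤-trans b≤ (≤-trans (m≤n+m B A) A+B≤N) ,
     ≤-trans c≤ (≤-trans c≤nA+1 (n*m+1≤[1+n]*k n A (A + B) 1≤A+B (m≤m+n A B))) ,
     ≤-trans d≤ (≤-trans d≤nB+1 (n*m+1≤[1+n]*k n B (A + B) 1≤A+B (m≤n+m B A)))
  where
    n A B : ℕ
    n = length σ
    A = a (F σ)
    B = b (F σ)
    A+B≤N : A + B ≤ suc n * (A + B)
    A+B≤N = m≤m+n (A + B) (n * (A + B))
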